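{- For any $\varepsilon > 0$, there exists a string $T$ of length $n$ (for some $n$) such that $|\mathcal{IS}_T| > (2-\varepsilon)n$.
   Context: For a string $S$ of length $n$ and $1 \le i \le j \le n$, $S[i..j]$ is the substring from position $i$ to position $j$; a non-empty substring is unique if it occurs exactly once in $S$ and repeating if it occurs at least twice; an interval $[i,j]$ is unique/repeating according to $S[i..j]$. $[s,t]\subset[i,j]$ means $i\le s$ and $t\le j$. For $1\le s\le t\le n$, an interval $[i,j]$ is a shortest unique substring (SUS) for $[s,t]$ if $S[i..j]$ is unique, $[s,t]\subset[i,j]$, and $S[i'..j']$ is repeating for every $[i',j']\supset[s,t]$ with $j'-i'<j-i$; $\mathsf{SUS}_S([s,t])$ is the set of SUSs for $[s,t]$. If $s\ne t$ and $[s,t]$ is unique, then $[s,t]$ is its own only SUS, called a trivial SUS; all other SUSs are non-trivial. $\mathcal{IS}_S$ is the set of all non-trivial SUSs of $S$, i.e. the union of $\mathsf{SUS}_S([s,t])$ over all query intervals $1\le s\le t\le n$ except those with $s\ne t$ and $[s,t]$ unique.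
   Formalization: The parameter ε ranges over the positive rationals. -}

module Defs where

open import Data.Bool using (Bool; true; false; _∧_; _∨_; not)
open import Data.Nat using (ℕ; zero; suc; _∸_; _≤ᵇ_; _<ᵇ_; _≡ᵇ_)
import Data.Nat as ℕ
open import Data.List using (List; []; _∷_; length; take; drop; map; upTo; concatMap; filterᵇ)
open import Data.Bool.ListAction using (any; all)
open import Data.List.Properties using (≡-dec)
open import Data.Product using (_×_; _,_)
open import Relation.Nullary.Decidable using (⌊_⌋)

String : Set
String = List ℕ

-- An interval [i,j] (1-based, inclusive).
Interval : Set
Interval = ℕ × ℕ

sub : String → ℕ → ℕ → String
sub S i j = take (suc j ∸ i) (drop (i ∸ 1) S)

-- number of occurrences of the (non-empty) word w in S:
-- starting positions k (0-based) with S[k .. k+|w|-1] = w.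
occ : String → String → ℕ
occ S w = length (filterᵇ (λ k → ⌊ ≡-dec ℕ._≟_ (take (length w) (drop k S)) w ⌋) (upTo (length S)))

allIntervals : ℕ → List Interval
allIntervals n = concatMap (λ i → map (λ j → (i , j)) (filterᵇ (λ j → i ≤ᵇ j) (map suc (upTo n)))) (map suc (upTo n))

isUnique : String → Interval → Bool
isUnique S (i , j) = occ S (sub S i j) ≡ᵇ 1

isRepeating : String → Interval → Bool
isRepeating S (i , j) = 2 ≤ᵇ occ S (sub S i j)

_⊂ᵇ_ : Interval → Interval → Bool
(s , t) ⊂ᵇ (i , j) = (i ≤ᵇ s) ∧ (t ≤ᵇ j)

isSUS : String → Interval → Interval → Bool
isSUS S st (i , j) =
  isUnique S (i , j) ∧ (st ⊂ᵇ (i , j)) ∧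
  all (λ { (i' , j') → not ((st ⊂ᵇ (i' , j')) ∧ ((j' ∸ i') <ᵇ (j ∸ i))) ∨ isRepeating S (i' , j') })
      (allIntervals (length S))

-- query [s,t] whose SUSs are non-trivial: excluded are those with s ≠ t and [s,t] unique
nontrivialQuery : String → Interval → Bool
nontrivialQuery S (s , t) = not (not (s ≡ᵇ t) ∧ isUnique S (s , t))

inIS : String → Interval → Bool
inIS S ij = any (λ st → nontrivialQuery S st ∧ isSUS S st ij) (allIntervals (length S))

-- |IS_S|  (every SUS is an interval within [1,n], so enumerating allIntervals n suffices)
cardIS : String → ℕ
cardIS S = length (filterᵇ (inIS S) (allIntervals (length S)))

module Submission where

-- The witness is  T_m = 0 1^(m+1) 2  of length n = m + 3.  Every block of ones
-- of length at most m occurs (at least) at positions 2 and 3, so it is repeating,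
-- while a prefix 0 1^k and a suffix 1^r 2 are unique (0 and 2 occur once).  Hence
--   [1, j+2]    is a SUS of the repeating block [2, j+2]      (j < m),
--   [j+3, m+3]  is a SUS of the repeating block [j+3, m+2]    (j < m),
-- because a unique interval that is one longer than a repeating interval it
-- contains is a SUS of it.  These 2m intervals are distinct, so |IS| ≥ 2m, and
-- for m = 6q the arithmetic gives (2 - p/q) n < |IS|.

open import Defs
open import Data.Nat using (ℕ; _+_; _*_; _<_)
open import Data.List using (length)
open import Data.Product using (∃-syntax)

open import Data.Bool using (Bool; true; false; T; not; _∧_; _∨_)
open import Data.Bool.Properties using (T-∧)
open import Data.Empty using (⊥-elim)
open import Data.List using (List; []; _∷_; _++_; map; take; drop; replicate; concat; upTo; applyUpTo; filterᵇ)
open import Data.List.Properties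
  using (applyUpTo-∷ʳ; filter-++; filter-accept; filter-reject; filter-all; filter-none; length-++; map-upTo;
         map-applyUpTo; length-applyUpTo; length-replicate; take-all; ∷-injectiveʳ; ≡-dec)
open import Data.List.Membership.Propositional using (_∈_; _∉_)
open import Data.List.Membership.Propositional.Properties using (∈-map⁺; ∈-filter⁺; ∈-upTo⁺; ∈-applyUpTo⁺; ∈-concat⁺′)
open import Data.List.Relation.Binary.Sublist.Propositional using (_⊆_; _∷_; _∷ʳ_; minimum; from∈; lookup; ⊆-trans)
open import Data.List.Relation.Binary.Sublist.Propositional.Properties using (filter⁺; length-mono-≤; ++⁺; ++⁺ˡ; take-⊆; drop-⊆)
open import Data.List.Relation.Unary.All using (All; []; _∷_; tabulate)
open import Data.List.Relation.Unary.All.Properties using (applyUpTo⁺₁; applyUpTo⁺₂; all⁻) renaming (++⁺ to All-++⁺)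
open import Data.List.Relation.Unary.Any using (here; there)
import Data.List.Relation.Unary.Any as Any
open import Data.List.Relation.Unary.Any.Properties using (any⁺)
open import Data.Nat using (zero; suc; _∸_; _≤_; z≤n; s≤s; s≤s⁻¹; z<s; s<s; >-nonZero; _≟_; _≤ᵇ_; _<ᵇ_; _≡ᵇ_)
open import Data.Nat.Properties
open import Data.Nat.Solver using (module +-*-Solver)
open import Data.Product using (_×_; _,_)
open import Data.Sum using (inj₁; inj₂)
open import Function using (_∘_; _$_; id; Equivalence)
open import Relation.Binary.PropositionalEquality
open import Relation.Nullary.Decidable using (⌊_⌋; T?; toWitness; fromWitness)

private
  variable
    A : Set

both : {a b : Bool} → T a → T b → T (a ∧ b)
both p q = Equivalence.from T-∧ (p , q)

implies : {a b : Bool} → (T a → T b) → T (not a ∨ b)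
implies {false} _   = _
implies {true}  a⇒b = a⇒b _

count-≥ : (P : A → Bool) {ws xs : List A} → ws ⊆ xs → All (T ∘ P) ws →
          length ws ≤ length (filterᵇ P xs)
count-≥ P {ws} {xs} ws⊆xs Pws = begin
  length ws               ≡⟨ cong length (filter-all (T? ∘ P) Pws) ⟨
  length (filterᵇ P ws)   ≤⟨ length-mono-≤ (filter⁺ (T? ∘ P) (T? ∘ P) (λ { refl Px → Px }) ws⊆xs) ⟩
  length (filterᵇ P xs)   ∎
  where open ≤-Reasoning

count-upTo-suc : (P : ℕ → Bool) (n : ℕ) →
  length (filterᵇ P (upTo (suc n))) ≡ length (filterᵇ P (upTo n)) + length (filterᵇ P (n ∷ []))
count-upTo-suc P n = begin
  length (filterᵇ P (upTo (suc n)))                   ≡⟨ cong (length ∘ filterᵇ P) (applyUpTo-∷ʳ id n) ⟨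
  length (filterᵇ P (upTo n ++ n ∷ []))               ≡⟨ cong length (filter-++ (T? ∘ P) (upTo n) (n ∷ [])) ⟩
  length (filterᵇ P (upTo n) ++ filterᵇ P (n ∷ []))   ≡⟨ length-++ (filterᵇ P (upTo n)) ⟩
  length (filterᵇ P (upTo n)) + length (filterᵇ P (n ∷ [])) ∎
  where open ≡-Reasoning

count-single : (P : ℕ → Bool) {c n : ℕ} → c < n → T (P c) → (∀ k → T (P k) → k ≡ c) →
               length (filterᵇ P (upTo n)) ≡ 1
count-single P {c} {suc n} c<1+n Pc only rewrite count-upTo-suc P n
  with m≤n⇒m<n∨m≡n (s≤s⁻¹ c<1+n)
... | inj₁ c<n rewrite count-single P c<n Pc only
                     | filter-reject (T? ∘ P) {n} {[]} (λ Pn → <-irrefl (sym (only n Pn)) c<n) = refl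
... | inj₂ refl rewrite filter-none (T? ∘ P) (applyUpTo⁺₁ id n (λ i<n Pi → <-irrefl (only _ Pi) i<n))
                      | filter-accept (T? ∘ P) {n} {[]} Pc = refl

pair⊆applyUpTo : (f : ℕ → A) {a b n : ℕ} → a < b → b < n → f a ∷ f b ∷ [] ⊆ applyUpTo f n
pair⊆applyUpTo f {zero}  {suc b} {suc n} _   b<n = refl ∷ from∈ (∈-applyUpTo⁺ (f ∘ suc) (s≤s⁻¹ b<n))
pair⊆applyUpTo f {suc a} {suc b} {suc n} a<b b<n = f 0 ∷ʳ pair⊆applyUpTo (f ∘ suc) (s≤s⁻¹ a<b) (s≤s⁻¹ b<n)

applyUpTo-⊆ : (f : ℕ → A) {m n : ℕ} → m ≤ n → applyUpTo f m ⊆ applyUpTo f n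
applyUpTo-⊆ f {zero}  {n}     _   = minimum _
applyUpTo-⊆ f {suc m} {suc n} m≤n = refl ∷ applyUpTo-⊆ (f ∘ suc) (s≤s⁻¹ m≤n)

applyUpTo⊆concat : (g : ℕ → A) (r : ℕ → List A) {m n : ℕ} → m ≤ n →
                   (∀ {k} → k < m → g k ∈ r k) → applyUpTo g m ⊆ concat (applyUpTo r n)
applyUpTo⊆concat g r {zero}  {n}     _   _   = minimum _
applyUpTo⊆concat g r {suc m} {suc n} m≤n g∈r =
  ++⁺ (from∈ (g∈r z<s)) (applyUpTo⊆concat (g ∘ suc) (r ∘ suc) (s≤s⁻¹ m≤n) (g∈r ∘ s<s))

occursAt : String → String → ℕ → Bool
occursAt S w k = ⌊ ≡-dec _≟_ (take (length w) (drop k S)) w ⌋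

occursAt-intro : (S w : String) (k : ℕ) → take (length w) (drop k S) ≡ w → T (occursAt S w k)
occursAt-intro S w k = fromWitness

occursAt-elim : (S w : String) (k : ℕ) → T (occursAt S w k) → take (length w) (drop k S) ≡ w
occursAt-elim S w k = toWitness

occ-≥2 : (S w : String) {a b : ℕ} → a < b → b < length S →
         T (occursAt S w a) → T (occursAt S w b) → 2 ≤ occ S w
occ-≥2 S w a<b b<n occ-a occ-b = count-≥ (occursAt S w) (pair⊆applyUpTo id a<b b<n) (occ-a ∷ occ-b ∷ [])

occ-≡1 : (S w : String) {c : ℕ} → c < length S → T (occursAt S w c) →
         (∀ k → T (occursAt S w k) → k ≡ c) → occ S w ≡ 1
occ-≡1 S w = count-single (occursAt S w)

letter-of-occurrence : {l p x : ℕ} {xs ys : List ℕ} → take l (drop p xs) ≡ x ∷ ys → x ∈ xs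
letter-of-occurrence {l} {p} {xs = xs} eq =
  lookup (⊆-trans (take-⊆ l (drop p xs)) (drop-⊆ p xs)) (subst (_ ∈_) (sym eq) (here refl))

unique-intro : (S : String) {i j : ℕ} {w : String} → sub S i j ≡ w → occ S w ≡ 1 → T (isUnique S (i , j))
unique-intro S refl once = ≡⇒≡ᵇ _ 1 once

repeating-intro : (S : String) {i j : ℕ} {w : String} → sub S i j ≡ w → 2 ≤ occ S w → T (isRepeating S (i , j))
repeating-intro S refl twice = ≤⇒≤ᵇ twice

repeating⇒nontrivial : (S : String) (st : Interval) → T (isRepeating S st) → T (nontrivialQuery S st)
repeating⇒nontrivial S (s , t) rep with occ S (sub S s t) | s ≡ᵇ t
... | suc (suc _) | true  = _
... | suc (suc _) | false = _

no-slack : ∀ i y z x → i + y + z + x ∸ i ≤ i + y + z ∸ (i + y) → y ≡ 0 × x ≡ 0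
no-slack i y z x short = m+n≡0⇒m≡0 y y+x≡0 , m+n≡0⇒n≡0 y y+x≡0
  where
  open +-*-Solver
  outer : i + y + z + x ∸ i ≡ y + x + z
  outer = trans (cong (_∸ i) (solve 4 (λ i y z x → i :+ y :+ z :+ x := i :+ (y :+ x :+ z)) refl i y z x))
                (m+n∸m≡n i (y + x + z))
  y+x≡0 : y + x ≡ 0
  y+x≡0 = n≤0⇒n≡0 (+-cancelʳ-≤ z (y + x) 0 (subst₂ _≤_ outer (m+n∸m≡n (i + y) z) short))

tight-superinterval : {i s t j : ℕ} → i ≤ s → s ≤ t → t ≤ j → j ∸ i ≤ t ∸ s → i ≡ s × j ≡ t
tight-superinterval {i} i≤s s≤t t≤j short
  with y , refl ← m≤n⇒∃[o]m+o≡n i≤s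
     | z , refl ← m≤n⇒∃[o]m+o≡n s≤t
     | x , refl ← m≤n⇒∃[o]m+o≡n t≤j
  with refl , refl ← no-slack i y z x short = sym (+-identityʳ i) , +-identityʳ _

-- A unique interval that contains a repeating interval [s,t] and is exactly one
-- position longer is a SUS of [s,t]: every shorter candidate is [s,t] itself.
sus-of-extension : (S : String) {s t i j : ℕ} → i ≤ s → s ≤ t → t ≤ j → j ∸ i ≡ suc (t ∸ s) →
                   T (isUnique S (i , j)) → T (isRepeating S (s , t)) → T (isSUS S (s , t) (i , j))
sus-of-extension S {s} {t} {i} {j} i≤s s≤t t≤j one-longer uniq rep =
  both uniq (both contains (all⁻ _ {allIntervals (length S)} (tabulate λ { {i' , j'} _ → shorter-repeats i' j' })))
  where
  contains : T ((s , t) ⊂ᵇ (i , j))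
  contains = both (≤⇒≤ᵇ i≤s) (≤⇒≤ᵇ t≤j)
  shorter-repeats : ∀ i' j' →
    T (not (((s , t) ⊂ᵇ (i' , j')) ∧ ((j' ∸ i') <ᵇ (j ∸ i))) ∨ isRepeating S (i' , j'))
  shorter-repeats i' j' = implies λ candidate → repeats (Equivalence.to T-∧ candidate)
    where
    repeats : T ((s , t) ⊂ᵇ (i' , j')) × T ((j' ∸ i') <ᵇ (j ∸ i)) → T (isRepeating S (i' , j'))
    repeats (contains , shorter) with i'≤s , t≤j' ← Equivalence.to T-∧ contains
      with refl , refl ← tight-superinterval (≤ᵇ⇒≤ i' s i'≤s) s≤t (≤ᵇ⇒≤ t j' t≤j')
                           (s≤s⁻¹ (subst (j' ∸ i' <_) one-longer (<ᵇ⇒< _ _ shorter))) = rep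

row : ℕ → ℕ → List Interval
row n i = map (λ j → (i , j)) (filterᵇ (λ j → i ≤ᵇ j) (map suc (upTo n)))

allIntervals-rows : (n : ℕ) → allIntervals n ≡ concat (applyUpTo (row n ∘ suc) n)
allIntervals-rows n = cong concat (begin
  map (row n) (map suc (upTo n))   ≡⟨ cong (map (row n)) (map-upTo suc n) ⟩
  map (row n) (applyUpTo suc n)    ≡⟨ map-applyUpTo suc (row n) n ⟩
  applyUpTo (row n ∘ suc) n        ∎)
  where open ≡-Reasoning

first-row : (n : ℕ) → row n 1 ≡ applyUpTo (λ k → (1 , suc k)) n
first-row n = begin
  map (1 ,_) (filterᵇ (1 ≤ᵇ_) (map suc (upTo n)))   ≡⟨ cong (map (1 ,_) ∘ filterᵇ (1 ≤ᵇ_)) (map-upTo suc n) ⟩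
  map (1 ,_) (filterᵇ (1 ≤ᵇ_) (applyUpTo suc n))    ≡⟨ cong (map (1 ,_)) (filter-all (T? ∘ (1 ≤ᵇ_)) (applyUpTo⁺₂ suc n _)) ⟩
  map (1 ,_) (applyUpTo suc n)                       ≡⟨ map-applyUpTo suc (1 ,_) n ⟩
  applyUpTo (λ k → (1 , suc k)) n                    ∎
  where open ≡-Reasoning

∈-row : {n i j : ℕ} → 1 ≤ i → i ≤ j → j ≤ n → (i , j) ∈ row n i
∈-row {n} {i} {suc j} _ i≤j@(s≤s _) j<n = ∈-map⁺ (i ,_) (∈-filter⁺ (T? ∘ (i ≤ᵇ_)) (∈-map⁺ suc (∈-upTo⁺ j<n)) (≤⇒≤ᵇ i≤j))

∈-allIntervals : {n i j : ℕ} → 1 ≤ i → i ≤ j → j ≤ n → (i , j) ∈ allIntervals n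
∈-allIntervals {n} {suc i} 1≤i i≤j j≤n =
  subst ((suc i , _) ∈_) (sym (allIntervals-rows n))
        (∈-concat⁺′ (∈-row 1≤i i≤j j≤n) (∈-applyUpTo⁺ (row n ∘ suc) (≤-trans i≤j j≤n)))

inIS-intro : (S : String) {s t : ℕ} (ij : Interval) → 1 ≤ s → s ≤ t → t ≤ length S →
             T (isRepeating S (s , t)) → T (isSUS S (s , t) ij) → T (inIS S ij)
inIS-intro S {s} {t} ij 1≤s s≤t t≤n rep sus =
  any⁺ _ (Any.map (λ { refl → both (repeating⇒nontrivial S (s , t) rep) sus }) (∈-allIntervals 1≤s s≤t t≤n))

onesTwo : ℕ → String
onesTwo zero    = 2 ∷ []
onesTwo (suc a) = 1 ∷ onesTwo a

witness : ℕ → String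
witness m = 0 ∷ onesTwo (suc m)

length-onesTwo : (a : ℕ) → length (onesTwo a) ≡ suc a
length-onesTwo zero    = refl
length-onesTwo (suc a) = cong suc (length-onesTwo a)

length-witness : (m : ℕ) → length (witness m) ≡ 3 + m
length-witness m = cong suc (length-onesTwo (suc m))

take-onesTwo : {k a : ℕ} → k ≤ a → take k (onesTwo a) ≡ replicate k 1
take-onesTwo {zero}          _   = refl
take-onesTwo {suc k} {suc a} k≤a = cong (1 ∷_) (take-onesTwo (s≤s⁻¹ k≤a))

drop-onesTwo : {p a : ℕ} → p ≤ a → drop p (onesTwo a) ≡ onesTwo (a ∸ p)
drop-onesTwo {zero}          _   = refl
drop-onesTwo {suc p} {suc a} p≤a = drop-onesTwo (s≤s⁻¹ p≤a)

0∉onesTwo : (a : ℕ) → 0 ∉ onesTwo a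
0∉onesTwo zero    (there ())
0∉onesTwo (suc a) (there 0∈) = 0∉onesTwo a 0∈

onesTwo-prefix : (r b : ℕ) → take (suc r) (onesTwo b) ≡ onesTwo r → r ≡ b
onesTwo-prefix zero    zero    _  = refl
onesTwo-prefix (suc r) (suc b) eq = cong suc (onesTwo-prefix r b (∷-injectiveʳ eq))

onesTwo-position : (r p a : ℕ) → take (suc r) (drop p (onesTwo a)) ≡ onesTwo r → p + r ≡ a
onesTwo-position r zero    a       eq = onesTwo-prefix r a eq
onesTwo-position r (suc p) (suc a) eq = cong suc (onesTwo-position r p a eq)
onesTwo-position zero    (suc zero)    zero ()
onesTwo-position (suc r) (suc zero)    zero ()
onesTwo-position zero    (suc (suc p)) zero ()
onesTwo-position (suc r) (suc (suc p)) zero ()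

ones-at : {k a : ℕ} → k ≤ a → take (length (replicate k 1)) (onesTwo a) ≡ replicate k 1
ones-at {k} k≤a = trans (cong (λ l → take l _) (length-replicate k)) (take-onesTwo k≤a)

-- Every block 1^k with k ≤ m occurs in T_m at the 0-based positions 1 and 2,
-- so it is repeating.
ones-repeat : {k m : ℕ} → k ≤ m → 2 ≤ occ (witness m) (replicate k 1)
ones-repeat {k} {m} k≤m =
  occ-≥2 (witness m) (replicate k 1) {1} {2} ≤-refl (subst (2 <_) (sym (length-witness m)) (s≤s (s≤s (s≤s z≤n))))
    (occursAt-intro (witness m) _ 1 (ones-at (m≤n⇒m≤1+n k≤m)))
    (occursAt-intro (witness m) _ 2 (ones-at k≤m))

-- The prefixes 0 1^k (k ≤ m+1) of T_m are unique, since 0 occurs only at position 0.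
prefix-unique : {k m : ℕ} → k ≤ suc m → occ (witness m) (0 ∷ replicate k 1) ≡ 1
prefix-unique {k} {m} k≤1+m =
  occ-≡1 (witness m) _ {0} z<s (occursAt-intro (witness m) _ 0 (cong (0 ∷_) (ones-at k≤1+m))) only-at-0
  where
  only-at-0 : ∀ p → T (occursAt (witness m) (0 ∷ replicate k 1) p) → p ≡ 0
  only-at-0 zero    _      = refl
  only-at-0 (suc p) occurs =
    ⊥-elim (0∉onesTwo (suc m) (letter-of-occurrence {p = p} (occursAt-elim (witness m) _ (suc p) occurs)))

-- The suffixes 1^r 2 (r ≤ m+1) of T_m are unique, since 2 occurs only at the end.
suffix-unique : {r m : ℕ} → r ≤ suc m → occ (witness m) (onesTwo r) ≡ 1
suffix-unique {r} {m} r≤1+m =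
  occ-≡1 (witness m) _ {suc start} start<n (occursAt-intro (witness m) _ (suc start) occurs-at-start) only-at-start
  where
  start = suc m ∸ r
  start<n : suc start < length (witness m)
  start<n = subst (suc start <_) (sym (length-witness m)) (s≤s (s≤s (m∸n≤m (suc m) r)))
  occurs-at-start : take (length (onesTwo r)) (drop start (onesTwo (suc m))) ≡ onesTwo r
  occurs-at-start rewrite drop-onesTwo (m∸n≤m (suc m) r) | m∸[m∸n]≡n r≤1+m = take-all _ (onesTwo r) ≤-refl
  prefix-of-length : ∀ {xs} → take (length (onesTwo r)) xs ≡ onesTwo r → take (suc r) xs ≡ onesTwo r
  prefix-of-length {xs} = subst (λ l → take l xs ≡ onesTwo r) (length-onesTwo r)
  only-at-start : ∀ p → T (occursAt (witness m) (onesTwo r) p) → p ≡ suc start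
  only-at-start zero    occurs =
    ⊥-elim (0∉onesTwo r (subst (0 ∈_) (prefix-of-length (occursAt-elim (witness m) _ 0 occurs)) (here refl)))
  only-at-start (suc p) occurs =
    cong suc (trans (sym (m+n∸n≡m p r)) (cong (_∸ r) (onesTwo-position r p (suc m)
      (prefix-of-length (occursAt-elim (witness m) _ (suc p) occurs)))))

-- [1, j+2] (j < m) is a SUS of the repeating block [2, j+2] = 1^(j+1).
prefix-in-IS : {m j : ℕ} → j < m → T (inIS (witness m) (1 , 2 + j))
prefix-in-IS {m} {j} j<m =
  inIS-intro S {2} {2 + j} (1 , 2 + j) (s≤s z≤n) (s≤s (s≤s z≤n)) 2+j≤n repeating
    (sus-of-extension S {2} {2 + j} {1} {2 + j} (s≤s z≤n) (s≤s (s≤s z≤n)) ≤-refl refl unique repeating)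
  where
  S = witness m
  1+j≤1+m = s≤s (<⇒≤ j<m)
  2+j≤n : 2 + j ≤ length S
  2+j≤n = subst (2 + j ≤_) (sym (length-witness m)) (s≤s (m≤n⇒m≤1+n 1+j≤1+m))
  repeating : T (isRepeating S (2 , 2 + j))
  repeating = repeating-intro S {2} {2 + j} (take-onesTwo 1+j≤1+m) (ones-repeat j<m)
  unique : T (isUnique S (1 , 2 + j))
  unique = unique-intro S {1} {2 + j} (cong (0 ∷_) (take-onesTwo 1+j≤1+m)) (prefix-unique 1+j≤1+m)

-- [j+3, m+3] (j < m) is a SUS of the repeating block [j+3, m+2] = 1^(m-j).
suffix-in-IS : {m j : ℕ} → j < m → T (inIS (witness m) (3 + j , 3 + m))
suffix-in-IS {m} {j} j<m =
  inIS-intro S {3 + j} {2 + m} (3 + j , 3 + m) (s≤s z≤n) (s≤s (s≤s j<m)) 2+m≤n repeating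
    (sus-of-extension S {3 + j} {2 + m} {3 + j} {3 + m} ≤-refl (s≤s (s≤s j<m)) (n≤1+n _) one-longer unique repeating)
  where
  S = witness m
  j≤m = <⇒≤ j<m
  -- (m + 3) - (j + 3) = m - j = 1 + (m + 2 - (j + 3))
  one-longer : m ∸ j ≡ suc (m ∸ suc j)
  one-longer = +-∸-assoc 1 j<m
  2+m≤n : 2 + m ≤ length S
  2+m≤n = subst (2 + m ≤_) (sym (length-witness m)) (n≤1+n _)
  repeating : T (isRepeating S (3 + j , 2 + m))
  repeating = repeating-intro S {3 + j} {2 + m}
    (trans (cong (take (m ∸ j)) (drop-onesTwo j≤m)) (take-onesTwo ≤-refl)) (ones-repeat (m∸n≤m m j))
  unique : T (isUnique S (3 + j , 3 + m))
  unique = unique-intro S {3 + j} {3 + m}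
    (begin
      take (suc m ∸ j) (drop j (onesTwo m))   ≡⟨ cong₂ take (+-∸-assoc 1 j≤m) (drop-onesTwo j≤m) ⟩
      take (suc (m ∸ j)) (onesTwo (m ∸ j))    ≡⟨ take-all _ _ (≤-reflexive (length-onesTwo (m ∸ j))) ⟩
      onesTwo (m ∸ j)                         ∎)
    (suffix-unique (m≤n⇒m≤1+n (m∸n≤m m j)))
    where open ≡-Reasoning

-- The 2m intervals above, listed in the order in which allIntervals enumerates them.
prefix-SUSs suffix-SUSs : ℕ → List Interval
prefix-SUSs m = applyUpTo (λ j → (1 , 2 + j)) m
suffix-SUSs m = applyUpTo (λ j → (3 + j , 3 + m)) m

-- The prefix SUSs lie in the first row, the suffix SUSs one per row from row 3 on.
SUSs⊆allIntervals : (m : ℕ) → prefix-SUSs m ++ suffix-SUSs m ⊆ allIntervals (3 + m)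
SUSs⊆allIntervals m = subst (prefix-SUSs m ++ suffix-SUSs m ⊆_) (sym (allIntervals-rows (3 + m))) $
  ++⁺ prefix⊆row1 (++⁺ˡ (row (3 + m) 2) suffix⊆rows)
  where
  prefix⊆row1 : prefix-SUSs m ⊆ row (3 + m) 1
  prefix⊆row1 = subst (prefix-SUSs m ⊆_) (sym (first-row (3 + m)))
                  ((1 , 1) ∷ʳ applyUpTo-⊆ (λ j → (1 , 2 + j)) (m≤n+m m 2))
  suffix⊆rows : suffix-SUSs m ⊆ concat (applyUpTo (λ k → row (3 + m) (3 + k)) (suc m))
  suffix⊆rows = applyUpTo⊆concat (λ j → (3 + j , 3 + m)) (λ k → row (3 + m) (3 + k)) (n≤1+n m)
                  (λ j<m → ∈-row (s≤s z≤n) (s≤s (s≤s (s≤s (<⇒≤ j<m)))) ≤-refl)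

cardIS-witness : (m : ℕ) → m + m ≤ cardIS (witness m)
cardIS-witness m = begin
  m + m                                            ≡⟨ cong₂ _+_ (length-applyUpTo prefix m) (length-applyUpTo suffix m) ⟨
  length (prefix-SUSs m) + length (suffix-SUSs m)  ≡⟨ length-++ (prefix-SUSs m) ⟨
  length (prefix-SUSs m ++ suffix-SUSs m)          ≤⟨ count-≥ (inIS (witness m)) SUSs⊆ all-in-IS ⟩
  cardIS (witness m)                               ∎
  where
  open ≤-Reasoning
  prefix suffix : ℕ → Interval
  prefix j = (1 , 2 + j)
  suffix j = (3 + j , 3 + m)
  SUSs⊆ : prefix-SUSs m ++ suffix-SUSs m ⊆ allIntervals (length (witness m))
  SUSs⊆ = subst (λ n → prefix-SUSs m ++ suffix-SUSs m ⊆ allIntervals n) (sym (length-witness m)) (SUSs⊆allIntervals m)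
  all-in-IS : All (T ∘ inIS (witness m)) (prefix-SUSs m ++ suffix-SUSs m)
  all-in-IS = All-++⁺ (applyUpTo⁺₁ prefix m prefix-in-IS) (applyUpTo⁺₁ suffix m suffix-in-IS)

-- With m = 6q and n = m + 3:  q·2m + n = 2qn + 3.
balance : (q : ℕ) → q * (6 * q + 6 * q) + (3 + 6 * q) ≡ 3 + 2 * q * (3 + 6 * q)
balance = solve 1 (λ q → q :* (con 6 :* q :+ con 6 :* q) :+ (con 3 :+ con 6 :* q)
                         := con 3 :+ con 2 :* q :* (con 3 :+ con 6 :* q)) refl
  where open +-*-Solver

-- For ε = p/q the witness T_{6q} satisfies (2 - ε) n < |IS|, i.e. 2qn < q|IS| + pn
-- (using only p ≥ 1).
lemma8 : (p q : ℕ) → 0 < p → 0 < q →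
    ∃[ T ] 2 * q * length T < q * cardIS T + p * length T
lemma8 p q 0<p _ = witness m , (begin-strict
  2 * q * length (witness m)               ≡⟨ cong (2 * q *_) (length-witness m) ⟩
  2 * q * n                                <⟨ m<n+m (2 * q * n) z<s ⟩
  3 + 2 * q * n                            ≡⟨ balance q ⟨
  q * (m + m) + n                          ≤⟨ +-mono-≤ (*-monoʳ-≤ q (cardIS-witness m)) (m≤n*m n p {{>-nonZero 0<p}}) ⟩
  q * cardIS (witness m) + p * n           ≡⟨ cong (λ l → q * cardIS (witness m) + p * l) (length-witness m) ⟨
  q * cardIS (witness m) + p * length (witness m) ∎)
  where
  open ≤-Reasoning
  m = 6 * q
  n = 3 + m
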